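{- Let $R$ be a commutative ring with $1$, $p$ a prime, $\sigma:R\to R$ a ring endomorphism with $\sigma(r)\equiv r^p\bmod pR$ for all $r\in R$, and $D:R\to R$ a derivation (an additive map with $D(r_1r_2)=D(r_1)r_2+r_1D(r_2)$). Then $D(\sigma^m(a))\in p^mR$ for all $a\in R$ and all $m\ge1$. -}

module Defs where

open import Level using (_⊔_)
open import Data.Nat using (ℕ; zero; suc)
open import Data.Product using (∃)
open import Algebra.Bundles using (CommutativeRing; Semiring)
import Algebra.Definitions.RawSemiring as RawSemiringDefs
import Algebra.Morphism.Structures as MorphismStructures

module _ {c ℓ : Level.Level} (R : CommutativeRing c ℓ) where
  open CommutativeRing R
  open RawSemiringDefs (Semiring.rawSemiring semiring) using (_×_; _^_)

  natR : ℕ → Carrier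
  natR n = n × 1#

  _∈_R : Carrier → ℕ → Set (c ⊔ ℓ)
  x ∈ n R = ∃ λ s → x ≈ natR n * s

  IsRingEndo : (Carrier → Carrier) → Set (c ⊔ ℓ)
  IsRingEndo σ = MorphismStructures.RingMorphisms.IsRingHomomorphism rawRing rawRing σ

  IsFrobeniusLift : ℕ → (Carrier → Carrier) → Set (c ⊔ ℓ)
  IsFrobeniusLift p σ = ∀ r → (σ r - r ^ p) ∈ p R

  record IsDerivation (D : Carrier → Carrier) : Set (c ⊔ ℓ) where
    field
      cong    : ∀ {x y} → x ≈ y → D x ≈ D y
      additive : ∀ x y → D (x + y) ≈ D x + D y
      leibniz : ∀ x y → D (x * y) ≈ D x * y + x * D y

  iter : ℕ → (Carrier → Carrier) → Carrier → Carrier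
  iter zero    f x = x
  iter (suc m) f x = f (iter m f x)

{-# OPTIONS --safe #-}
-- Expand σ(x) = x^p + p·y inside D ∘ σ^m: the power rule gives
-- D((σ^m x)^p) = p·(σ^m x)^(p-1)·D(σ^m x), and p·D(σ^m y) is the other term, so
-- induction on m gains one factor p per application of σ.
module Submission where

open import Defs
open import Data.Nat using (ℕ; suc; _^_)
open import Data.Nat.Primality using (Prime)
open import Algebra.Bundles using (CommutativeRing)
open import Level using (Level)

open import Data.Nat using (zero)
import Data.Nat as ℕ
open import Data.Nat.Primality using (¬prime[0])
open import Data.Empty using (⊥-elim)
open import Data.Product using (_,_)
open import Relation.Binary.PropositionalEquality as ≡ using (_≡_)
open import Algebra.Bundles using (Semiring)
import Algebra.Definitions.RawSemiring as RawSemiringDefs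
open import Algebra.Morphism.Structures using (module RingMorphisms)
import Algebra.Morphism.Construct.Composition as Composition
import Algebra.Morphism.Construct.Identity as Identity
import Algebra.Properties.Ring as RingProperties
import Algebra.Properties.Semiring.Mult as SemiringMult
import Relation.Binary.Reasoning.Setoid as SetoidReasoning

module _ {c ℓ : Level} (R : CommutativeRing c ℓ) where
  open CommutativeRing R
  open RawSemiringDefs (Semiring.rawSemiring semiring) renaming (_^_ to _^R_)
  open RingProperties ring using (x+x≈x⇒x≈0; //-rightDividesˡ)
  open SemiringMult semiring using (×1-homo-*)
  open SetoidReasoning setoid
  open RingMorphisms rawRing rawRing using (IsRingHomomorphism)

  infix 4 _∈⟨_⟩
  _∈⟨_⟩ : Carrier → ℕ → Set _
  x ∈⟨ n ⟩ = _∈_R R x n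

  ∈⟨⟩-resp-≈ : ∀ {n x y} → x ≈ y → y ∈⟨ n ⟩ → x ∈⟨ n ⟩
  ∈⟨⟩-resp-≈ x≈y (s , y≈ns) = s , trans x≈y y≈ns

  ∈⟨⟩-+ : ∀ {n x y} → x ∈⟨ n ⟩ → y ∈⟨ n ⟩ → x + y ∈⟨ n ⟩
  ∈⟨⟩-+ {n} (s , x≈ns) (t , y≈nt) =
    s + t , trans (+-cong x≈ns y≈nt) (sym (distribˡ (natR R n) s t))

  ∈⟨⟩-*ˡ : ∀ {n} x {y} → y ∈⟨ n ⟩ → x * y ∈⟨ n ⟩
  ∈⟨⟩-*ˡ {n} x {y} (s , y≈ns) = x * s , (begin
    x * y              ≈⟨ *-congˡ y≈ns ⟩
    x * (natR R n * s) ≈⟨ *-assoc x (natR R n) s ⟨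
    x * natR R n * s   ≈⟨ *-congʳ (*-comm x (natR R n)) ⟩
    natR R n * x * s   ≈⟨ *-assoc (natR R n) x s ⟩
    natR R n * (x * s) ∎)

  natR-*-∈⟨*⟩ : ∀ m {n y} → y ∈⟨ n ⟩ → natR R m * y ∈⟨ m ℕ.* n ⟩
  natR-*-∈⟨*⟩ m {n} {y} (s , y≈ns) = s , (begin
    natR R m * y              ≈⟨ *-congˡ y≈ns ⟩
    natR R m * (natR R n * s) ≈⟨ *-assoc (natR R m) (natR R n) s ⟨
    natR R m * natR R n * s   ≈⟨ *-congʳ (×1-homo-* m n) ⟨
    natR R (m ℕ.* n) * s      ∎)

  module RingEndomorphism {τ : Carrier → Carrier} (τ-endo : IsRingEndo R τ) where
    open IsRingHomomorphism τ-endo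

    natR-homo : ∀ n → τ (natR R n) ≈ natR R n
    natR-homo zero    = 0#-homo
    natR-homo (suc n) = trans (+-homo 1# (natR R n)) (+-cong 1#-homo (natR-homo n))

    ^-homo : ∀ x n → τ (x ^R n) ≈ τ x ^R n
    ^-homo x zero    = 1#-homo
    ^-homo x (suc n) = trans (*-homo x (x ^R n)) (*-congˡ (^-homo x n))

  iter-isRingEndo : ∀ {σ} → IsRingEndo R σ → ∀ m → IsRingEndo R (iter R m σ)
  iter-isRingEndo σ-endo zero    = Identity.isRingHomomorphism rawRing refl
  iter-isRingEndo σ-endo (suc m) =
    Composition.isRingHomomorphism trans (iter-isRingEndo σ-endo m) σ-endo

  iter-suc : ∀ (f : Carrier → Carrier) m x → iter R (suc m) f x ≡ iter R m f (f x)
  iter-suc f zero    x = ≡.refl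
  iter-suc f (suc m) x = ≡.cong f (iter-suc f m x)

  module Derivation {D : Carrier → Carrier} (D-derivation : IsDerivation R D) where
    open IsDerivation D-derivation renaming (cong to D-cong)

    D-0# : D 0# ≈ 0#
    D-0# = x+x≈x⇒x≈0 (D 0#) (trans (sym (additive 0# 0#)) (D-cong (+-identityʳ 0#)))

    D-1# : D 1# ≈ 0#
    D-1# = x+x≈x⇒x≈0 (D 1#) (begin
      D 1# + D 1#           ≈⟨ +-cong (*-identityʳ (D 1#)) (*-identityˡ (D 1#)) ⟨
      D 1# * 1# + 1# * D 1# ≈⟨ leibniz 1# 1# ⟨
      D (1# * 1#)           ≈⟨ D-cong (*-identityˡ 1#) ⟩
      D 1#                  ∎)

    D-natR : ∀ n → D (natR R n) ≈ 0#
    D-natR zero    = D-0#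
    D-natR (suc n) = begin
      D (1# + natR R n)    ≈⟨ additive 1# (natR R n) ⟩
      D 1# + D (natR R n)  ≈⟨ +-cong D-1# (D-natR n) ⟩
      0# + 0#              ≈⟨ +-identityʳ 0# ⟩
      0#                   ∎

    D-natR-* : ∀ n x → D (natR R n * x) ≈ natR R n * D x
    D-natR-* n x = begin
      D (natR R n * x)                     ≈⟨ leibniz (natR R n) x ⟩
      D (natR R n) * x + natR R n * D x    ≈⟨ +-congʳ (trans (*-congʳ (D-natR n)) (zeroˡ x)) ⟩
      0# + natR R n * D x                  ≈⟨ +-identityˡ (natR R n * D x) ⟩
      natR R n * D x                       ∎

    D-^ : ∀ x n → D (x ^R suc n) ≈ natR R (suc n) * (x ^R n * D x)
    D-^ x zero = begin
      D (x * 1#)            ≈⟨ D-cong (*-identityʳ x) ⟩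
      D x                   ≈⟨ *-identityˡ (D x) ⟨
      1# * D x              ≈⟨ *-cong (+-identityʳ 1#) (*-identityˡ (D x)) ⟨
      natR R 1 * (1# * D x) ∎
    D-^ x (suc n) = begin
      D (x * x ^R suc n)                              ≈⟨ leibniz x (x ^R suc n) ⟩
      D x * x ^R suc n + x * D (x ^R suc n)           ≈⟨ +-cong (*-comm (D x) (x ^R suc n)) (*-congˡ (D-^ x n)) ⟩
      x ^R suc n * D x + x * (k * (x ^R n * D x))     ≈⟨ +-cong (sym (*-identityˡ _)) (rearrange x k (x ^R n) (D x)) ⟩
      1# * (x ^R suc n * D x) + k * (x ^R suc n * D x) ≈⟨ distribʳ (x ^R suc n * D x) 1# k ⟨
      (1# + k) * (x ^R suc n * D x)                   ∎
      where
      k = natR R (suc n)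
      rearrange : ∀ a b c d → a * (b * (c * d)) ≈ b * (a * c * d)
      rearrange a b c d = begin
        a * (b * (c * d)) ≈⟨ *-assoc a b (c * d) ⟨
        a * b * (c * d)   ≈⟨ *-congʳ (*-comm a b) ⟩
        b * a * (c * d)   ≈⟨ *-assoc b a (c * d) ⟩
        b * (a * (c * d)) ≈⟨ *-congˡ (*-assoc a c d) ⟨
        b * (a * c * d)   ∎

    module _ {σ : Carrier → Carrier} (σ-endo : IsRingEndo R σ) where

      D-iter-∈⟨^⟩ : ∀ {k} → IsFrobeniusLift R (suc k) σ →
                    ∀ m x → D (iter R m σ x) ∈⟨ suc k ^ m ⟩
      D-iter-∈⟨^⟩ frob zero x = D x , sym (trans (*-congʳ (+-identityʳ 1#)) (*-identityˡ (D x)))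
      D-iter-∈⟨^⟩ {k} frob (suc m) x with frob x
      ... | y , σx-xᵖ≈py =
        ∈⟨⟩-resp-≈ {n = p ^ suc m} D-σᵐ⁺¹x (natR-*-∈⟨*⟩ p {n = p ^ m} sum∈⟨pᵐ⟩)
        where
        p = suc k
        τ = iter R m σ
        u = τ x
        open IsRingHomomorphism (iter-isRingEndo σ-endo m)
        open RingEndomorphism (iter-isRingEndo σ-endo m)

        sum∈⟨pᵐ⟩ : D (τ y) + u ^R k * D u ∈⟨ p ^ m ⟩
        sum∈⟨pᵐ⟩ = ∈⟨⟩-+ {n = p ^ m}
          (D-iter-∈⟨^⟩ frob m y) (∈⟨⟩-*ˡ {n = p ^ m} (u ^R k) (D-iter-∈⟨^⟩ frob m x))

        σx≈py+xᵖ : σ x ≈ natR R p * y + x ^R p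
        σx≈py+xᵖ = trans (sym (//-rightDividesˡ (x ^R p) (σ x))) (+-congʳ σx-xᵖ≈py)

        τ-natR-* : ∀ z → τ (natR R p * z) ≈ natR R p * τ z
        τ-natR-* z = trans (*-homo (natR R p) z) (*-congʳ (natR-homo p))

        D-σᵐ⁺¹x : D (iter R (suc m) σ x) ≈ natR R p * (D (τ y) + u ^R k * D u)
        D-σᵐ⁺¹x = begin
          D (iter R (suc m) σ x)                         ≡⟨ ≡.cong D (iter-suc σ m x) ⟩
          D (τ (σ x))                                    ≈⟨ D-cong (⟦⟧-cong σx≈py+xᵖ) ⟩
          D (τ (natR R p * y + x ^R p))                  ≈⟨ D-cong (+-homo _ _) ⟩
          D (τ (natR R p * y) + τ (x ^R p))              ≈⟨ D-cong (+-cong (τ-natR-* y) (^-homo x p)) ⟩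
          D (natR R p * τ y + u ^R p)                    ≈⟨ additive _ _ ⟩
          D (natR R p * τ y) + D (u ^R p)                ≈⟨ +-cong (D-natR-* p (τ y)) (D-^ u k) ⟩
          natR R p * D (τ y) + natR R p * (u ^R k * D u) ≈⟨ distribˡ (natR R p) _ _ ⟨
          natR R p * (D (τ y) + u ^R k * D u)            ∎

-- Primality only rules out p = 0, and the bound holds for m = 0 as well.
lemma4 : ∀ {c ℓ : Level} (R : CommutativeRing c ℓ) (p : ℕ) → Prime p →
    (σ : CommutativeRing.Carrier R → CommutativeRing.Carrier R) → IsRingEndo R σ → IsFrobeniusLift R p σ →
    (D : CommutativeRing.Carrier R → CommutativeRing.Carrier R) → IsDerivation R D →
    ∀ (a : CommutativeRing.Carrier R) (m : ℕ) → 1 Data.Nat.≤ m →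
    _∈_R R (D (iter R m σ a)) (p ^ m)
lemma4 R zero    p-prime σ σ-endo frob D D-derivation a m _ = ⊥-elim (¬prime[0] p-prime)
lemma4 R (suc k) p-prime σ σ-endo frob D D-derivation a m _ =
  Derivation.D-iter-∈⟨^⟩ R D-derivation σ-endo frob m a
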